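{- Suppose that for all fixed $m,b$ and $N$ sufficiently large, $f_N(m, b+1)<f_N(m, b)<f_N(m+1, b)$, with both differences tending to infinity as $N\to\infty$. Then for fixed $p$ and $n$ sufficiently large, the $(p,2p+1)$-biased Clique game on $K_n$ is won by player $2$.
   Context: Two players, Alice (player 1, starting) and Bob (player 2), alternately colour uncoloured edges of the complete graph $K_n$, Alice in red and Bob in blue; in the $(p,q)$-biased version Alice colours $p$ edges per turn and Bob $q$ edges per turn. In the Clique game, Alice's score is $a=\omega(G[A])$ and Bob's is $b=\omega(G[B])$, the clique numbers of the red and blue graphs; when $q>p$, Bob (player 2) wins if at the end $b>a$. For the Maker–Breaker clique game, $f_N(m,b)$ denotes the largest $q$ such that Maker can occupy a $K_q$ in the $(m:b)$ game (Maker claims $m$ edges, Breaker $b$ edges per turn) played on $K_N$. -}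

module Defs where

open import Data.Nat using (ℕ; zero; suc; _+_; _≤_)
open import Data.Fin using (Fin; _<_; _≟_)
open import Data.Maybe using (Maybe; just; nothing)
open import Data.Bool using (if_then_else_; _∧_)
open import Data.Product using (Σ; _×_; ∃)
open import Relation.Nullary using (¬_)
open import Relation.Nullary.Decidable using (⌊_⌋)
open import Relation.Binary.PropositionalEquality using (_≡_; _≢_)

-- Players: P1 = Alice / Maker (red, moves first), P2 = Bob / Breaker (blue).
data Player : Set where
  P1 P2 : Player

other : Player → Player
other P1 = P2
other P2 = P1

-- A (partial) 2-colouring of the edges of K_n.  Edge {i,j} with i < j is
-- stored at position (i , j); entries with ¬ (i < j) are irrelevant.
-- nothing = uncoloured, just P = coloured by player P.
Board : ℕ → Set
Board n = Fin n → Fin n → Maybe Player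

empty : {n : ℕ} → Board n
empty _ _ = nothing

paint : {n : ℕ} → Board n → Fin n → Fin n → Player → Board n
paint c i j P x y = if ⌊ x ≟ i ⌋ ∧ ⌊ y ≟ j ⌋ then just P else c x y

Full : {n : ℕ} → Board n → Set
Full {n} c = (i j : Fin n) → i < j → ¬ (c i j ≡ nothing)

quota : ℕ → ℕ → Player → ℕ
quota p q P1 = p
quota p q P2 = q

-- A turn of k edges is played as k consecutive single-edge moves by the same
-- player (equivalent, since the opponent does not move in between).  If the
-- board fills up during a turn, the game ends.
-- State after one edge: (mover, edges left in current turn).
nextMover : ℕ → ℕ → Player → ℕ → Player
nextMover p q P (suc (suc k)) = P
nextMover p q P _ = other P

nextLeft : ℕ → ℕ → Player → ℕ → ℕ
nextLeft p q P (suc (suc k)) = suc k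
nextLeft p q P _ = quota p q (other P)

-- Wins n p q W Goal c mv k : player W has a strategy guaranteeing that the
-- final (fully coloured) board satisfies Goal, from position c where player
-- mv is to move with k edges left in its current turn.  (Finite game, so the
-- inductive attractor definition is the usual notion of a winning strategy.)
data Wins (n p q : ℕ) (W : Player) (Goal : Board n → Set)
       : Board n → Player → ℕ → Set where
  done  : ∀ {c mv k} → Full c → Goal c → Wins n p q W Goal c mv k
  move  : ∀ {c mv k} (i j : Fin n) → mv ≡ W → i < j → c i j ≡ nothing →
          Wins n p q W Goal (paint c i j mv) (nextMover p q mv k) (nextLeft p q mv k) →
          Wins n p q W Goal c mv k
  block : ∀ {c mv k} → mv ≢ W → ¬ Full c →
          ((i j : Fin n) → i < j → c i j ≡ nothing →
            Wins n p q W Goal (paint c i j mv) (nextMover p q mv k) (nextLeft p q mv k)) →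
          Wins n p q W Goal c mv k

WinsGame : (n p q : ℕ) → Player → (Board n → Set) → Set
WinsGame n p q W Goal = Wins n p q W Goal empty P1 p

HasClique : {n : ℕ} → Board n → Player → ℕ → Set
HasClique {n} c P k =
  Σ (Fin k → Fin n) λ f →
    ((x y : Fin k) → x < y → f x < f y) ×
    ((x y : Fin k) → x < y → c (f x) (f y) ≡ just P)

CliqueNumber : {n : ℕ} → Board n → Player → ℕ → Set
CliqueNumber c P w = HasClique c P w × ¬ HasClique c P (suc w)

P2WinsClique : {n : ℕ} → Board n → Set
P2WinsClique c = ∃ λ a → ∃ λ b → CliqueNumber c P1 a × CliqueNumber c P2 b × Data.Nat._<_ a b

MakerCanBuild : (N m b k : ℕ) → Set
MakerCanBuild N m b k = WinsGame N m b P1 (λ c → HasClique c P1 k)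

-- f_N(m,b) = v : the largest k such that Maker can occupy a K_k
IsF : (N m b v : ℕ) → Set
IsF N m b v = MakerCanBuild N m b v × ¬ MakerCanBuild N m b (suc v)

-- Bob plays two auxiliary Maker-Breaker games at once, spending 2p + 1 = p + (p + 1)
-- edges per turn. On the last N vertices he is Breaker in the (p : p) game against
-- a red K_(y+1), where y = f_N(p, p); on N vertices avoiding the at most 2p vertices
-- of Alice's first turn he is Maker in the (p + 1 : p) game for a blue K_z, where
-- z = f_N(p + 1, p). Every red clique then has fewer than 2p + y + 1 vertices, since
-- at most 2p of them lie outside the last N, and the gap hypothesis for D = 2p
-- gives 2p + y + 1 ≤ z. For N large, blue therefore wins.
module Submission where

open import Defs
open import Data.Fin as Fin using (Fin; _<_; _≟_; toℕ)
import Data.Fin.Properties as Fin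
open import Data.Fin.Induction using (<-weakInduction)
open import Data.List using (List; []; _∷_; length)
open import Data.List.Membership.Propositional using (_∈_; _∉_)
open import Data.List.Relation.Unary.Any using (here; there)
open import Data.Maybe using (Maybe; just; nothing)
open import Data.Maybe.Properties using (≡-dec; just-injective)
open import Data.Nat as ℕ using (ℕ; zero; suc; _+_; _*_; _≤_; z≤n; s≤s)
open import Data.Nat.Induction using (<-wellFounded)
import Data.Nat.Properties as ℕ
open import Data.Nat.Solver using (module +-*-Solver)
open import Data.Product using (Σ; _×_; ∃; _,_; proj₁; proj₂)
open import Data.Sum using (_⊎_; inj₁; inj₂; [_,_]′)
open import Data.Unit using (⊤; tt)
open import Function using (_∘_; id)
open import Induction.WellFounded using (module All)
import Relation.Binary.Construct.On as On
open import Relation.Binary.Definitions using (tri<; tri≈; tri>)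
open import Relation.Binary.PropositionalEquality
open import Relation.Nullary using (¬_; Dec; yes; no; ¬?; contradiction)
open import Relation.Nullary.Decidable using (map′; decidable-stable; _×-dec_; _→-dec_)

open +-*-Solver using (solve; _:+_; _:*_; _:=_; con)

_≟ᴾ_ : (P Q : Player) → Dec (P ≡ Q)
P1 ≟ᴾ P1 = yes refl
P1 ≟ᴾ P2 = no λ ()
P2 ≟ᴾ P1 = no λ ()
P2 ≟ᴾ P2 = yes refl

other≢ : ∀ P → other P ≢ P
other≢ P1 ()
other≢ P2 ()

≢other⇒≡ : ∀ {P Q} → P ≢ other Q → P ≡ Q
≢other⇒≡ {P1} {P1} _     = refl
≢other⇒≡ {P1} {P2} P≢P1 = contradiction refl P≢P1
≢other⇒≡ {P2} {P1} P≢P2 = contradiction refl P≢P2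
≢other⇒≡ {P2} {P2} _     = refl

just≢nothing : ∀ {P : Player} → just P ≢ nothing
just≢nothing ()

isNothing? : (m : Maybe Player) → Dec (m ≡ nothing)
isNothing? nothing  = yes refl
isNothing? (just _) = no just≢nothing

coloured-by-other : ∀ (m : Maybe Player) Q → m ≢ nothing → m ≢ just Q → m ≡ just (other Q)
coloured-by-other nothing   Q  m≢nothing _ = contradiction refl m≢nothing
coloured-by-other (just P1) P1 _ m≢Q = contradiction refl m≢Q
coloured-by-other (just P2) P1 _ _   = refl
coloured-by-other (just P1) P2 _ _   = refl
coloured-by-other (just P2) P2 _ m≢Q = contradiction refl m≢Q

fill-with : Player → Maybe Player → Maybe Player
fill-with W nothing  = just W
fill-with W (just P) = just P

∑ : ∀ {k} → (Fin k → ℕ) → ℕ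
∑ {zero}  f = 0
∑ {suc k} f = f Fin.zero + ∑ (f ∘ Fin.suc)

∑-mono-≤ : ∀ {k} {f g : Fin k → ℕ} → (∀ x → f x ≤ g x) → ∑ f ≤ ∑ g
∑-mono-≤ {zero}  f≤g = z≤n
∑-mono-≤ {suc k} f≤g = ℕ.+-mono-≤ (f≤g Fin.zero) (∑-mono-≤ (f≤g ∘ Fin.suc))

∑-mono-< : ∀ {k} {f g : Fin k → ℕ} → (∀ x → f x ≤ g x) → ∀ a → f a ℕ.< g a → ∑ f ℕ.< ∑ g
∑-mono-< f≤g Fin.zero    fa<ga = ℕ.+-mono-<-≤ fa<ga (∑-mono-≤ (f≤g ∘ Fin.suc))
∑-mono-< f≤g (Fin.suc a) fa<ga = ℕ.+-mono-≤-< (f≤g Fin.zero) (∑-mono-< (f≤g ∘ Fin.suc) a fa<ga)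

isFree : Maybe Player → ℕ
isFree nothing  = 1
isFree (just _) = 0

module _ {n : ℕ} where

  paint-hit : ∀ (c : Board n) i j P → paint c i j P i j ≡ just P
  paint-hit c i j P with i ≟ i | j ≟ j
  ... | yes _  | yes _  = refl
  ... | no i≢i | _      = contradiction refl i≢i
  ... | yes _  | no j≢j = contradiction refl j≢j

  paint-cases : ∀ (c : Board n) i j P x y → (x ≡ i × y ≡ j) ⊎ paint c i j P x y ≡ c x y
  paint-cases c i j P x y with x ≟ i | y ≟ j
  ... | yes x≡i | yes y≡j = inj₁ (x≡i , y≡j)
  ... | yes _   | no _    = inj₂ refl
  ... | no _    | _       = inj₂ refl

  paint-or : ∀ (c : Board n) i j P x y → paint c i j P x y ≡ just P ⊎ paint c i j P x y ≡ c x y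
  paint-or c i j P x y with paint-cases c i j P x y
  ... | inj₁ (refl , refl) = inj₁ (paint-hit c i j P)
  ... | inj₂ unchanged     = inj₂ unchanged

  FreeEdge : Board n → (Fin n → Fin n → Set) → Set
  FreeEdge c Q = Σ (Fin n) λ i → Σ (Fin n) λ j → i < j × c i j ≡ nothing × Q i j

  AllFree : Board n → (Fin n → Fin n → Set) → Set
  AllFree c Q = ∀ i j → i < j → c i j ≡ nothing → Q i j

  FreeEdge-map : ∀ {c Q Q′} → (∀ i j → Q i j → Q′ i j) → FreeEdge c Q → FreeEdge c Q′
  FreeEdge-map f (i , j , i<j , free , q) = i , j , i<j , free , f i j q

  DecidableOnFree : Board n → (Fin n → Fin n → Set) → Set
  DecidableOnFree c Q = ∀ i j → c i j ≡ nothing → Dec (Q i j)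

  freeEdge? : ∀ c {Q} → DecidableOnFree c Q → Dec (FreeEdge c Q)
  freeEdge? c {Q} Q? = Fin.any? λ i → Fin.any? λ j → (i Fin.<? j) ×-dec free-and i j
    where
    free-and : ∀ i j → Dec (c i j ≡ nothing × Q i j)
    free-and i j with isNothing? (c i j)
    ... | yes free = map′ (free ,_) proj₂ (Q? i j free)
    ... | no ¬free = no (¬free ∘ proj₁)

  ¬FreeEdge¬⇒AllFree : ∀ c {Q} → DecidableOnFree c Q → ¬ FreeEdge c (λ i j → ¬ Q i j) → AllFree c Q
  ¬FreeEdge¬⇒AllFree c Q? ¬free i j i<j free =
    decidable-stable (Q? i j free) λ ¬q → ¬free (i , j , i<j , free , ¬q)

  ¬AllFree⇒FreeEdge : ∀ c {Q} → DecidableOnFree c Q → ¬ AllFree c Q → FreeEdge c (λ i j → ¬ Q i j)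
  ¬AllFree⇒FreeEdge c Q? ¬all with freeEdge? c (λ i j free → ¬? (Q? i j free))
  ... | yes free = free
  ... | no ¬free = contradiction (¬FreeEdge¬⇒AllFree c Q? ¬free) ¬all

  allFree? : ∀ c {Q} → DecidableOnFree c Q → Dec (AllFree c Q)
  allFree? c Q? with freeEdge? c (λ i j free → ¬? (Q? i j free))
  ... | yes (i , j , i<j , free , ¬q) = no λ all → ¬q (all i j i<j free)
  ... | no ¬free                       = yes (¬FreeEdge¬⇒AllFree c Q? ¬free)

  full? : (c : Board n) → Dec (Full c)
  full? c = allFree? c (λ _ _ _ → no λ ())

  ¬Full⇒FreeEdge : ∀ c → ¬ Full c → FreeEdge c (λ _ _ → ⊤)
  ¬Full⇒FreeEdge c ¬full = FreeEdge-map (λ _ _ _ → tt) (¬AllFree⇒FreeEdge c (λ _ _ _ → no λ ()) ¬full)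

  freeCount : Board n → ℕ
  freeCount c = ∑ λ x → ∑ λ y → isFree (c x y)

  freeCount-paint : ∀ c {i j} P → c i j ≡ nothing → freeCount (paint c i j P) ℕ.< freeCount c
  freeCount-paint c {i} {j} P free =
    ∑-mono-< (λ x → ∑-mono-≤ (paint-isFree x)) i (∑-mono-< (paint-isFree i) j hit)
    where
    paint-isFree : ∀ x y → isFree (paint c i j P x y) ≤ isFree (c x y)
    paint-isFree x y with paint-or c i j P x y
    ... | inj₁ hit       rewrite hit       = z≤n
    ... | inj₂ unchanged rewrite unchanged = ℕ.≤-refl
    hit : isFree (paint c i j P i j) ℕ.< isFree (c i j)
    hit rewrite paint-hit c i j P | free = s≤s z≤n

  paint-ind : (R : Board n → Set) →
    (∀ c → (∀ {i j} P → c i j ≡ nothing → R (paint c i j P)) → R c) → ∀ c → R c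
  paint-ind R step = All.wfRec (On.wellFounded freeCount <-wellFounded) _ R
    λ c ih → step c λ P free → ih (freeCount-paint c P free)

  fill : Player → Board n → Board n
  fill W c x y = fill-with W (c x y)

  Extends : Player → Board n → Board n → Set
  Extends W c c′ = ∀ x y → c′ x y ≡ c x y ⊎ c′ x y ≡ just W

  UpwardClosed : Player → (Board n → Set) → Set
  UpwardClosed W Goal = ∀ {c c′} → Extends W c c′ → Goal c → Goal c′

  fill-extends : ∀ W c → Extends W c (fill W c)
  fill-extends W c x y with c x y
  ... | nothing = inj₂ refl
  ... | just _  = inj₁ refl

  fill-paint-extends : ∀ W c {i j} P → c i j ≡ nothing → Extends W (fill W (paint c i j P)) (fill W c)
  fill-paint-extends W c {i} {j} P free x y with paint-cases c i j P x y
  ... | inj₁ (refl , refl) rewrite free      = inj₂ refl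
  ... | inj₂ unchanged     rewrite unchanged = inj₁ refl

-- Games

module Game (n p q : ℕ) where

  After : (Board n → Player → ℕ → Set) → Board n → Player → ℕ → Fin n → Fin n → Set
  After R c mv k i j = R (paint c i j mv) (nextMover p q mv k) (nextLeft p q mv k)

  module _ {W : Player} {Goal : Board n → Set} (Inv : Board n → Player → ℕ → Set)
    (goal    : ∀ {c mv k} → Inv c mv k → Full c → Goal c)
    (advance : ∀ {c mv k} → Inv c mv k → mv ≡ W → ¬ Full c → FreeEdge c (After Inv c mv k))
    (respond : ∀ {c mv k} → Inv c mv k → mv ≢ W → AllFree c (After Inv c mv k))
    where

    WinsFrom : Board n → Set
    WinsFrom c = ∀ {mv k} → Inv c mv k → Wins n p q W Goal c mv k

    wins-by-invariant : ∀ {c} → WinsFrom c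
    wins-by-invariant {c} = paint-ind WinsFrom step c
      where
      step : ∀ c → (∀ {i j} P → c i j ≡ nothing → WinsFrom (paint c i j P)) → WinsFrom c
      step c ih {mv} inv with full? c | mv ≟ᴾ W
      ... | yes full | _ = done full (goal inv full)
      ... | no ¬full | yes mv≡W =
        let i , j , i<j , free , inv′ = advance inv mv≡W ¬full
        in move i j mv≡W i<j free (ih mv free inv′)
      ... | no ¬full | no mv≢W =
        block mv≢W ¬full λ i j i<j free → ih mv free (respond inv mv≢W i j i<j free)

  module _ (W : Player) {Goal : Board n → Set} (goal? : ∀ c → Dec (Goal c)) where

    Decided : Board n → Set
    Decided c = ∀ mv k → Dec (Wins n p q W Goal c mv k)

    wins? : ∀ c → Decided c
    wins? = paint-ind Decided step
      where
      step : ∀ c → (∀ {i j} P → c i j ≡ nothing → Decided (paint c i j P)) → Decided c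
      step c ih mv k with full? c | mv ≟ᴾ W
      ... | yes full | _ = map′ (done full) goal-of (goal? c)
        where
        goal-of : Wins n p q W Goal c mv k → Goal c
        goal-of (done _ g)              = g
        goal-of (move i j _ i<j free _) = contradiction free (full i j i<j)
        goal-of (block _ ¬full _)       = contradiction full ¬full
      ... | no ¬full | yes mv≡W =
        map′ (λ (i , j , i<j , free , w) → move i j mv≡W i<j free w) winning-move
             (freeEdge? c λ i j free → ih mv free _ _)
        where
        winning-move : Wins n p q W Goal c mv k → FreeEdge c (After (Wins n p q W Goal) c mv k)
        winning-move (done full _)           = contradiction full ¬full
        winning-move (move i j _ i<j free w) = i , j , i<j , free , w
        winning-move (block mv≢W _ _)        = contradiction mv≡W mv≢W
      ... | no ¬full | no mv≢W =
        map′ (block mv≢W ¬full) every-reply-wins (allFree? c λ i j free → ih mv free _ _)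
        where
        every-reply-wins : Wins n p q W Goal c mv k → AllFree c (After (Wins n p q W Goal) c mv k)
        every-reply-wins (done full _)         = contradiction full ¬full
        every-reply-wins (move _ _ mv≡W _ _ _) = contradiction mv≡W mv≢W
        every-reply-wins (block _ _ replies)   = replies

    ¬wins⇒other-wins : ∀ {c mv k} → ¬ Wins n p q W Goal c mv k →
                       Wins n p q (other W) (λ c → ¬ Goal c) c mv k
    ¬wins⇒other-wins = wins-by-invariant (λ c mv k → ¬ Wins n p q W Goal c mv k)
      (λ ¬w full g → ¬w (done full g))
      (λ {c} ¬w mv≡otherW ¬full → ¬AllFree⇒FreeEdge c (λ _ _ _ → wins? _ _ _)
        λ replies → ¬w (block (λ mv≡W → other≢ W (trans (sym mv≡otherW) mv≡W)) ¬full replies))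
      (λ ¬w mv≢otherW i j i<j free w → ¬w (move i j (≢other⇒≡ mv≢otherW) i<j free w))

  -- fill W c extends, in W's colour, every board at which a play from c can end.
  wins⇒goal-of-fill : ∀ {W Goal} → UpwardClosed W Goal → ∀ {c mv k} →
                      Wins n p q W Goal c mv k → Goal (fill W c)
  wins⇒goal-of-fill up (done {c} _ g) = up (fill-extends _ c) g
  wins⇒goal-of-fill up (move {c} {mv} i j _ _ free w) =
    up (fill-paint-extends _ c mv free) (wins⇒goal-of-fill up w)
  wins⇒goal-of-fill up (block {c} {mv} _ ¬full replies) =
    let i , j , i<j , free , _ = ¬Full⇒FreeEdge c ¬full
    in up (fill-paint-extends _ c mv free) (wins⇒goal-of-fill up (replies i j i<j free))

-- Increasing maps between vertex sets

Increasing : ∀ {k m} → (Fin k → Fin m) → Set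
Increasing f = ∀ x y → x < y → f x < f y

increasing-injective : ∀ {k m} {f : Fin k → Fin m} → Increasing f → ∀ x y → f x ≡ f y → x ≡ y
increasing-injective inc x y fx≡fy with Fin.<-cmp x y
... | tri< x<y _ _ = contradiction (inc x y x<y) (Fin.<-irrefl fx≡fy)
... | tri≈ _ x≡y _ = x≡y
... | tri> _ _ y<x = contradiction (inc y x y<x) (Fin.<-irrefl (sym fx≡fy))

increasing⇒≥ : ∀ {k m} {f : Fin k → Fin m} → Increasing f → ∀ x → toℕ x ≤ toℕ (f x)
increasing⇒≥ {suc _} {f = f} inc = <-weakInduction (λ x → toℕ x ≤ toℕ (f x)) z≤n λ x ih →
  ℕ.≤-<-trans (subst (_≤ toℕ (f (Fin.inject₁ x))) (Fin.toℕ-inject₁ x) ih)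
              (inc _ _ (Fin.≤̄⇒inject₁< ℕ.≤-refl))

↑ʳ-increasing : ∀ k {m} → Increasing {m} (k Fin.↑ʳ_)
↑ʳ-increasing k x y x<y =
  subst₂ ℕ._<_ (sym (Fin.toℕ-↑ʳ k x)) (sym (Fin.toℕ-↑ʳ k y)) (ℕ.+-monoʳ-< k x<y)

↑ʳ-split : ∀ k {m} (i : Fin (k + m)) → k ≤ toℕ i → Σ (Fin m) λ w → k Fin.↑ʳ w ≡ i
↑ʳ-split zero    i           _         = i , refl
↑ʳ-split (suc k) (Fin.suc i) (s≤s k≤i) = let w , eq = ↑ʳ-split k i k≤i in w , cong Fin.suc eq

punchIn-increasing : ∀ {n} (i : Fin (suc n)) → Increasing (Fin.punchIn i)
punchIn-increasing i x y x<y with Fin.punchIn i x Fin.<? Fin.punchIn i y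
... | yes lt = lt
... | no ¬lt = contradiction (Fin.punchIn-cancel-≤ i y x (ℕ.≮⇒≥ ¬lt)) (ℕ.<⇒≱ x<y)

punchOut-or : ∀ {n} (v w : Fin (suc n)) → Fin n → Fin n
punchOut-or v w d with v ≟ w
... | yes _  = d
... | no v≢w = Fin.punchOut v≢w

punchIn-punchOut-or : ∀ {n} (v w : Fin (suc n)) d → v ≢ w → Fin.punchIn v (punchOut-or v w d) ≡ w
punchIn-punchOut-or v w d v≢w with v ≟ w
... | yes v≡w  = contradiction v≡w v≢w
... | no v≢w′ = Fin.punchIn-punchOut v≢w′

increasing-avoiding : ∀ k m (vs : Fin k → Fin (k + m)) →
  Σ (Fin m → Fin (k + m)) λ e → Increasing e × (∀ x t → e x ≢ vs t)
increasing-avoiding zero    m vs = id , (λ _ _ → id) , λ _ ()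
increasing-avoiding (suc k) m vs =
  let e , e-inc , e-avoids = increasing-avoiding k m vs′
  in Fin.punchIn v ∘ e , (λ x y x<y → punchIn-increasing v _ _ (e-inc x y x<y)) , avoids e e-avoids
  where
  v = vs Fin.zero
  vs′ : Fin k → Fin (k + m)
  vs′ t = punchOut-or v (vs (Fin.suc t)) (t Fin.↑ˡ m)
  avoids : ∀ e → (∀ x t → e x ≢ vs′ t) → ∀ x t → Fin.punchIn v (e x) ≢ vs t
  avoids e _ x Fin.zero = Fin.punchInᵢ≢i v (e x)
  avoids e e-avoids x (Fin.suc t) eq with v ≟ vs (Fin.suc t)
  ... | yes v≡vₜ = Fin.punchInᵢ≢i v (e x) (trans eq (sym v≡vₜ))
  ... | no v≢vₜ  = e-avoids x t (Fin.punchIn-injective v _ _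
                     (trans eq (sym (punchIn-punchOut-or v (vs (Fin.suc t)) (t Fin.↑ˡ m) v≢vₜ))))

lookup-padded : ∀ {A : Set} → List A → A → (K : ℕ) → Fin K → A
lookup-padded []       d K       t           = d
lookup-padded (w ∷ ws) d zero    ()
lookup-padded (w ∷ ws) d (suc K) Fin.zero    = w
lookup-padded (w ∷ ws) d (suc K) (Fin.suc t) = lookup-padded ws d K t

∈⇒lookup-padded : ∀ {A : Set} {ws : List A} d K → length ws ≤ K → ∀ {w} → w ∈ ws →
                  Σ (Fin K) λ t → lookup-padded ws d K t ≡ w
∈⇒lookup-padded d (suc K) _            (here refl)  = Fin.zero , refl
∈⇒lookup-padded d (suc K) (s≤s |ws|≤K) (there w∈ws) =
  let t , eq = ∈⇒lookup-padded d K |ws|≤K w∈ws in Fin.suc t , eq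

increasing-avoiding-list : ∀ k m (ws : List (Fin (k + m))) → length ws ≤ k →
  Σ (Fin m → Fin (k + m)) λ e → Increasing e × (∀ x → e x ∉ ws)
increasing-avoiding-list k m []          _      = k Fin.↑ʳ_ , ↑ʳ-increasing k , λ _ ()
increasing-avoiding-list k m ws@(w ∷ _) |ws|≤k =
  let e , e-inc , e-avoids = increasing-avoiding k m (lookup-padded ws w k)
  in e , e-inc , λ x ex∈ws → let t , eq = ∈⇒lookup-padded w k |ws|≤k ex∈ws in e-avoids x t (sym eq)

any-function? : ∀ k {m} (Q : (Fin k → Fin m) → Set) → (∀ f → Dec (Q f)) →
                (∀ {f g} → (∀ x → f x ≡ g x) → Q f → Q g) → Dec (Σ (Fin k → Fin m) Q)
any-function? zero Q Q? resp = map′ (_ ,_) (λ (f , qf) → resp (λ ()) qf) (Q? λ ())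
any-function? (suc k) Q Q? resp = map′
  (λ (a , g , q) → cons a g , q)
  (λ (f , qf) → f Fin.zero , f ∘ Fin.suc , resp (λ { Fin.zero → refl ; (Fin.suc x) → refl }) qf)
  (Fin.any? λ a → any-function? k (Q ∘ cons a) (Q? ∘ cons a)
    λ f≗g → resp λ { Fin.zero → refl ; (Fin.suc x) → f≗g x })
  where
  cons : ∀ {m} → Fin m → (Fin k → Fin m) → Fin (suc k) → Fin m
  cons a g Fin.zero    = a
  cons a g (Fin.suc x) = g x

last-before-failure : (R : ℕ → Set) → (∀ v → Dec (R v)) → R 0 → ∀ K → ¬ R (suc K) →
                      Σ ℕ λ v → R v × ¬ R (suc v)
last-before-failure R R? r₀ zero    ¬r = 0 , r₀ , ¬r
last-before-failure R R? r₀ (suc K) ¬r with R? (suc K)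
... | yes r  = suc K , r , ¬r
... | no ¬r′ = last-before-failure R R? r₀ K ¬r′

induced : ∀ {m n} → (Fin m → Fin n) → Board n → Board m
induced e c i j = c (e i) (e j)

module _ {N : ℕ} (c : Board N) (P : Player) where

  hasClique? : ∀ k → Dec (HasClique c P k)
  hasClique? k = any-function? k _
    (λ f → (Fin.all? λ x → Fin.all? λ y → x Fin.<? y →-dec f x Fin.<? f y)
     ×-dec (Fin.all? λ x → Fin.all? λ y → x Fin.<? y →-dec ≡-dec _≟ᴾ_ (c (f x) (f y)) (just P)))
    λ f≗g (inc , col) → (λ x y x<y → subst₂ _<_ (f≗g x) (f≗g y) (inc x y x<y))
                      , (λ x y x<y → subst₂ (λ a b → c a b ≡ just P) (f≗g x) (f≗g y) (col x y x<y))

  hasClique-≤ : ∀ {k k′} → k′ ≤ k → HasClique c P k → HasClique c P k′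
  hasClique-≤ k′≤k (f , inc , col) =
    f ∘ inject , (λ x y x<y → inc _ _ (inject-< x y x<y)) , (λ x y x<y → col _ _ (inject-< x y x<y))
    where
    inject = λ x → Fin.inject≤ x k′≤k
    inject-< : ∀ x y → x < y → inject x < inject y
    inject-< x y = subst₂ ℕ._<_ (sym (Fin.toℕ-inject≤ x k′≤k)) (sym (Fin.toℕ-inject≤ y k′≤k))

  ¬HasClique-suc : ¬ HasClique c P (suc N)
  ¬HasClique-suc (f , inc , _) with Fin.pigeonhole (ℕ.n<1+n N) f
  ... | x , y , x<y , fx≡fy = Fin.<-irrefl fx≡fy (inc x y x<y)

  cliqueNumber-exists : Σ ℕ (CliqueNumber c P)
  cliqueNumber-exists = last-before-failure _ hasClique? ((λ ()) , (λ ()) , (λ ())) N ¬HasClique-suc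

module _ {N : ℕ} {c : Board N} {P : Player} {w : ℕ} (ω≡w : CliqueNumber c P w) where

  cliqueNumber-< : ∀ {K} → ¬ HasClique c P K → w ℕ.< K
  cliqueNumber-< {K} ¬clique with w ℕ.<? K
  ... | yes w<K = w<K
  ... | no  w≮K = contradiction (hasClique-≤ c P (ℕ.≮⇒≥ w≮K) (proj₁ ω≡w)) ¬clique

  cliqueNumber-≥ : ∀ {K} → HasClique c P K → K ≤ w
  cliqueNumber-≥ {K} clique with K ℕ.≤? w
  ... | yes K≤w = K≤w
  ... | no  K≰w = contradiction (hasClique-≤ c P (ℕ.≰⇒> K≰w) clique) (proj₂ ω≡w)

hasClique-induced : ∀ {m n} {e : Fin m → Fin n} → Increasing e → ∀ {c P k} →
                    HasClique (induced e c) P k → HasClique c P k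
hasClique-induced e-inc (g , g-inc , col) = _ , (λ x y x<y → e-inc _ _ (g-inc x y x<y)) , col

hasClique-drop : ∀ k {m} {c : Board (k + m)} {P Y} → HasClique c P (k + Y) →
                 HasClique (induced (k Fin.↑ʳ_) c) P Y
hasClique-drop k {m} {c} {P} {Y} (f , f-inc , col) = g , g-inc , λ x y x<y →
  subst₂ (λ a b → c a b ≡ just P) (sym (g-spec x)) (sym (g-spec y)) (col _ _ (↑ʳ-increasing k x y x<y))
  where
  split : ∀ x → Σ (Fin m) λ w → k Fin.↑ʳ w ≡ f (k Fin.↑ʳ x)
  split x = ↑ʳ-split k (f (k Fin.↑ʳ x))
    (ℕ.≤-trans (subst (k ≤_) (sym (Fin.toℕ-↑ʳ k x)) (ℕ.m≤m+n k (toℕ x)))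
               (increasing⇒≥ f-inc (k Fin.↑ʳ x)))
  g : Fin Y → Fin m
  g = proj₁ ∘ split
  g-spec : ∀ x → k Fin.↑ʳ g x ≡ f (k Fin.↑ʳ x)
  g-spec = proj₂ ∘ split
  g-inc : Increasing g
  g-inc x y x<y = ℕ.+-cancelˡ-< k _ _ (subst₂ ℕ._<_ (Fin.toℕ-↑ʳ k (g x)) (Fin.toℕ-↑ʳ k (g y))
    (subst₂ _<_ (sym (g-spec x)) (sym (g-spec y)) (f-inc _ _ (↑ʳ-increasing k x y x<y))))

module _ {N : ℕ} where

  hasClique-upward : ∀ P k → UpwardClosed P (λ (c : Board N) → HasClique c P k)
  hasClique-upward P k c⊑c′ (f , inc , col) = f , inc , λ x y x<y → stays (c⊑c′ (f x) (f y)) (col x y x<y)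
    where
    stays : ∀ {a b : Maybe Player} → b ≡ a ⊎ b ≡ just P → a ≡ just P → b ≡ just P
    stays (inj₁ b≡a) a≡P = trans b≡a a≡P
    stays (inj₂ b≡P) _   = b≡P

  ¬hasClique-upward : ∀ P k → UpwardClosed (other P) (λ (c : Board N) → ¬ HasClique c P k)
  ¬hasClique-upward P k c⊑c′ ¬clique (f , inc , col) =
    ¬clique (f , inc , λ x y x<y → was (c⊑c′ (f x) (f y)) (col x y x<y))
    where
    was : ∀ {a b : Maybe Player} → b ≡ a ⊎ b ≡ just (other P) → b ≡ just P → a ≡ just P
    was (inj₁ b≡a)      b≡P = trans (sym b≡a) b≡P
    was (inj₂ b≡otherP) b≡P = contradiction (just-injective (trans (sym b≡otherP) b≡P)) (other≢ P)

module _ (N m b : ℕ) where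

  makerCanBuild? : ∀ k → Dec (MakerCanBuild N m b k)
  makerCanBuild? k = Game.wins? N m b P1 (λ c → hasClique? c P1 k) empty P1 m

  makerCanBuild-0 : MakerCanBuild N m b 0
  makerCanBuild-0 = Game.wins-by-invariant N m b (λ _ _ _ → ⊤)
    (λ _ _ → (λ ()) , (λ ()) , (λ ()))
    (λ {c} _ _ ¬full → ¬Full⇒FreeEdge c ¬full)
    (λ _ _ _ _ _ _ → tt)
    tt

  isF-exists : Σ ℕ (IsF N m b)
  isF-exists = last-before-failure _ makerCanBuild? makerCanBuild-0 N λ maker →
    ¬HasClique-suc (fill P1 empty) P1 (Game.wins⇒goal-of-fill N m b (hasClique-upward P1 (suc N)) maker)

-- Playing an auxiliary game on a copy of K_m inside K_n

-- Bob, who is P2 on the board c of K_n, plays as B on a shadow board d of K_m whose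
-- vertices are mapped into K_n by e: B's edges of d are blue in c, and Alice's red
-- edges inside the image of e are recorded in d as moves of the other player. When
-- Alice plays outside the image (or on an already recorded edge) the other player
-- moves arbitrarily in d; Bob's blue edges outside the image are ignored.
module Simulation {m n : ℕ} (e : Fin m → Fin n) (e-inc : Increasing e)
                  (B : Player) (p q : ℕ) (Goal : Board m → Set) where

  record Consistent (d : Board m) (c : Board n) : Set where
    field
      B-blue    : ∀ i j → i < j → d i j ≡ just B → c (e i) (e j) ≡ just P2
      red-other : ∀ i j → i < j → c (e i) (e j) ≡ just P1 → d i j ≡ just (other B)
  open Consistent

  Shadowed : Board n → Player → ℕ → Set
  Shadowed c mv k = Σ (Board m) λ d → Wins m p q B Goal d mv k × Consistent d c

  Grows : Player → Board m → Board m → Set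
  Grows Q d d′ = ∀ x y → d′ x y ≡ d x y ⊎ (d x y ≡ nothing × d′ x y ≡ just Q)

  grows-refl : ∀ Q d → Grows Q d d
  grows-refl Q d x y = inj₁ refl

  grows-paint : ∀ Q d {i j} → d i j ≡ nothing → Grows Q d (paint d i j Q)
  grows-paint Q d {i} {j} free x y with paint-cases d i j Q x y
  ... | inj₁ (refl , refl) = inj₂ (free , paint-hit d i j Q)
  ... | inj₂ unchanged     = inj₁ unchanged

  consistent-red : ∀ {d d′ c a b} → Consistent d c → c a b ≡ nothing → Grows (other B) d d′ →
    (∀ i j → i < j → e i ≡ a → e j ≡ b → d′ i j ≡ just (other B)) → Consistent d′ (paint c a b P1)
  consistent-red {d} {d′} {c} {a} {b} cons free grows recorded = record
    { B-blue    = λ i j i<j d′≡B → B-blue′ i j i<j d′≡B (grows i j)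
    ; red-other = λ i j i<j red → red-other′ i j i<j red (paint-cases c a b P1 (e i) (e j)) }
    where
    B-blue′ : ∀ i j → i < j → d′ i j ≡ just B →
              d′ i j ≡ d i j ⊎ (d i j ≡ nothing × d′ i j ≡ just (other B)) →
              paint c a b P1 (e i) (e j) ≡ just P2
    B-blue′ i j i<j d′≡B (inj₂ (_ , d′≡other)) =
      contradiction (just-injective (trans (sym d′≡other) d′≡B)) (other≢ B)
    B-blue′ i j i<j d′≡B (inj₁ d′≡d)
      with B-blue cons i j i<j (trans (sym d′≡d) d′≡B) | paint-cases c a b P1 (e i) (e j)
    ... | blue | inj₁ (refl , refl) = contradiction (trans (sym blue) free) just≢nothing
    ... | blue | inj₂ unchanged     = trans unchanged blue
    red-other′ : ∀ i j → i < j → paint c a b P1 (e i) (e j) ≡ just P1 →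
                 (e i ≡ a × e j ≡ b) ⊎ paint c a b P1 (e i) (e j) ≡ c (e i) (e j) → d′ i j ≡ just (other B)
    red-other′ i j i<j _   (inj₁ (ei≡a , ej≡b)) = recorded i j i<j ei≡a ej≡b
    red-other′ i j i<j red (inj₂ unchanged) with red-other cons i j i<j (trans (sym unchanged) red) | grows i j
    ... | d≡other | inj₁ d′≡d         = trans d′≡d d≡other
    ... | d≡other | inj₂ (d≡free , _) = contradiction (trans (sym d≡other) d≡free) just≢nothing

  consistent-blue : ∀ {d c a b} → Consistent d c → Consistent d (paint c a b P2)
  consistent-blue {d} {c} {a} {b} cons = record
    { B-blue    = λ i j i<j d≡B →
        [ id , (λ unchanged → trans unchanged (B-blue cons i j i<j d≡B)) ]′ (paint-or c a b P2 (e i) (e j))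
    ; red-other = λ i j i<j red →
        [ (λ blue → contradiction (trans (sym red) blue) λ ())
        , (λ unchanged → red-other cons i j i<j (trans (sym unchanged) red)) ]′ (paint-or c a b P2 (e i) (e j)) }

  consistent-B-move : ∀ {d c i j a b} → Consistent d c → d i j ≡ nothing →
    paint c a b P2 (e i) (e j) ≡ just P2 → Consistent (paint d i j B) (paint c a b P2)
  consistent-B-move {d} {c} {i} {j} {a} {b} cons free blue = record
    { B-blue    = λ x y x<y B-edge →
        [ (λ { (refl , refl) → blue })
        , (λ unchanged → B-blue cons′ x y x<y (trans (sym unchanged) B-edge)) ]′ (paint-cases d i j B x y)
    ; red-other = λ x y x<y red →
        [ (λ { (refl , refl) → contradiction (trans (sym (red-other cons′ x y x<y red)) free) just≢nothing })
        , (λ unchanged → trans unchanged (red-other cons′ x y x<y red)) ]′ (paint-cases d i j B x y) }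
    where
    cons′ : Consistent d (paint c a b P2)
    cons′ = consistent-blue cons

  simulate-blue-elsewhere : ∀ {c mv k a b} → Shadowed c mv k → Shadowed (paint c a b P2) mv k
  simulate-blue-elsewhere (d , w , cons) = d , w , consistent-blue cons

  simulate-red : ∀ {c k a b} → Shadowed c (other B) k → c a b ≡ nothing →
                 Shadowed (paint c a b P1) (nextMover p q (other B) k) (nextLeft p q (other B) k)
  simulate-red {c} {k} {a} {b} (d , w , cons) free = reply w
    where
    not-B : ∀ {i j} → i < j → e i ≡ a → e j ≡ b → d i j ≢ just B
    not-B {i} {j} i<j refl refl d≡B = just≢nothing (trans (sym (B-blue cons i j i<j d≡B)) free)

    recorded : ∀ {i j} →
      (∀ {i′ j′} → i′ < j′ → e i′ ≡ a → e j′ ≡ b → d i′ j′ ≡ nothing → i′ ≡ i × j′ ≡ j) →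
      ∀ i′ j′ → i′ < j′ → e i′ ≡ a → e j′ ≡ b → paint d i j (other B) i′ j′ ≡ just (other B)
    recorded {i} {j} only-free i′ j′ i′<j′ ei′≡a ej′≡b with isNothing? (d i′ j′)
    ... | yes d-free with only-free i′<j′ ei′≡a ej′≡b d-free
    ...   | refl , refl = paint-hit d i j (other B)
    recorded {i} {j} only-free i′ j′ i′<j′ ei′≡a ej′≡b | no d-coloured =
      [ id , (λ unchanged → trans unchanged
                 (coloured-by-other (d i′ j′) B d-coloured (not-B i′<j′ ei′≡a ej′≡b))) ]′
        (paint-or d i j (other B) i′ j′)

    reply : Wins m p q B Goal d (other B) k →
            Shadowed (paint c a b P1) (nextMover p q (other B) k) (nextLeft p q (other B) k)
    reply (done full g) = d , done full g , consistent-red cons free (grows-refl _ d)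
      λ i j i<j ei≡a ej≡b → coloured-by-other (d i j) B (full i j i<j) (not-B i<j ei≡a ej≡b)
    reply (move _ _ otherB≡B _ _ _) = contradiction otherB≡B (other≢ B)
    reply (block _ ¬full replies) with freeEdge? d (λ i j _ → (e i ≟ a) ×-dec (e j ≟ b))
    ... | yes (i , j , i<j , d-free , refl , refl) =
      paint d i j (other B) , replies i j i<j d-free ,
      consistent-red cons free (grows-paint _ d d-free) (recorded λ _ ei′≡ei ej′≡ej _ →
        increasing-injective e-inc _ _ ei′≡ei , increasing-injective e-inc _ _ ej′≡ej)
    ... | no no-free-preimage =
      let i , j , i<j , d-free , _ = ¬Full⇒FreeEdge d ¬full
      in paint d i j (other B) , replies i j i<j d-free ,
         consistent-red cons free (grows-paint _ d d-free) (recorded λ i′<j′ ei′≡a ej′≡b d-free′ →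
           contradiction (_ , _ , i′<j′ , d-free′ , ei′≡a , ej′≡b) no-free-preimage)

  simulate-blue : ∀ {c k} → Shadowed c B k → ¬ Full c →
    FreeEdge c (λ a b → Shadowed (paint c a b P2) (nextMover p q B k) (nextLeft p q B k))
  simulate-blue {c} {k} (d , w , cons) ¬full = respond w
    where
    respond : Wins m p q B Goal d B k →
      FreeEdge c (λ a b → Shadowed (paint c a b P2) (nextMover p q B k) (nextLeft p q B k))
    respond (done full g) =
      FreeEdge-map (λ _ _ _ → d , done full g , consistent-blue cons) (¬Full⇒FreeEdge c ¬full)
    respond (block B≢B _ _) = contradiction refl B≢B
    respond (move i j _ i<j d-free w′) =
      FreeEdge-map (λ _ _ blue → paint d i j B , w′ , consistent-B-move cons d-free blue) cover
      where
      not-red : c (e i) (e j) ≢ just P1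
      not-red red = just≢nothing (trans (sym (red-other cons i j i<j red)) d-free)

      -- If the image of B's edge is already coloured, it is blue and any free edge will do.
      cover : FreeEdge c (λ a b → paint c a b P2 (e i) (e j) ≡ just P2)
      cover with isNothing? (c (e i) (e j))
      ... | yes c-free = e i , e j , e-inc i j i<j , c-free , paint-hit c (e i) (e j) P2
      ... | no c-coloured = FreeEdge-map
        (λ a b _ → [ id , (λ unchanged → trans unchanged (coloured-by-other _ P1 c-coloured not-red)) ]′
                     (paint-or c a b P2 (e i) (e j)))
        (¬Full⇒FreeEdge c ¬full)

module _ {m n : ℕ} {e : Fin m → Fin n} (e-inc : Increasing e) {p q : ℕ} where

  maker-shadow⇒clique : ∀ {z c mv k} → Full c →
    Simulation.Shadowed e e-inc P1 p q (λ d → HasClique d P1 z) c mv k → HasClique (induced e c) P2 z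
  maker-shadow⇒clique {z} {c} full (d , w , cons) =
    let g , g-inc , col = Game.wins⇒goal-of-fill m p q (hasClique-upward P1 z) w
    in g , g-inc , λ x y x<y → blue (g-inc x y x<y) (col x y x<y)
    where
    open Simulation.Consistent cons
    blue : ∀ {i j} → i < j → fill-with P1 (d i j) ≡ just P1 → c (e i) (e j) ≡ just P2
    blue {i} {j} i<j filled with d i j in d≡
    ... | just P1 = B-blue i j i<j d≡
    ... | just P2 = contradiction filled λ ()
    ... | nothing = coloured-by-other (c (e i) (e j)) P1 (full (e i) (e j) (e-inc i j i<j))
                      λ red → just≢nothing (trans (sym (red-other i j i<j red)) d≡)

  breaker-shadow⇒¬clique : ∀ {Y c mv k} →
    Simulation.Shadowed e e-inc P2 p q (λ d → ¬ HasClique d P1 Y) c mv k → ¬ HasClique (induced e c) P1 Y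
  breaker-shadow⇒¬clique {Y} (d , w , cons) (g , g-inc , red) =
    Game.wins⇒goal-of-fill m p q (¬hasClique-upward P1 Y) w (g , g-inc , λ x y x<y →
      cong (fill-with P2) (Simulation.Consistent.red-other cons _ _ (g-inc x y x<y) (red x y x<y)))

-- Bob's strategy

module BobStrategy (p′ N′′ y z : ℕ) (gap : 2 * suc p′ + suc y ≤ z)
  (maker : MakerCanBuild (suc (suc N′′)) (suc (suc p′)) (suc p′) z)
  (¬maker : ¬ MakerCanBuild (suc (suc N′′)) (suc p′) (suc p′) (suc y)) where

  p N n q : ℕ
  p = suc p′
  N = suc (suc N′′)
  n = 2 * p + N
  q = 2 * p + 1

  Goal₁ Goal₂ : Board N → Set
  Goal₁ d = HasClique d P1 z
  Goal₂ d = ¬ HasClique d P1 (suc y)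

  breaker : Wins N p p P2 Goal₂ empty P1 p
  breaker = Game.¬wins⇒other-wins N p p P1 (λ c → hasClique? c P1 (suc y)) ¬maker

  e₂ : Fin N → Fin n
  e₂ = (2 * p) Fin.↑ʳ_

  e₂-inc : Increasing e₂
  e₂-inc = ↑ʳ-increasing (2 * p)

  module S₁ (e₁ : Fin N → Fin n) (e₁-inc : Increasing e₁) = Simulation e₁ e₁-inc P1 (suc p) p Goal₁
  module S₂ = Simulation e₂ e₂-inc P2 p p Goal₂

  Covers : Board n → List (Fin n) → Set
  Covers c L = ∀ a b → a < b → c a b ≢ nothing → a ∈ L × b ∈ L

  covers-paint : ∀ {c L a b} P → Covers c L → Covers (paint c a b P) (a ∷ b ∷ L)
  covers-paint {c} {L} {a} {b} P cov x y x<y coloured with paint-cases c a b P x y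
  ... | inj₁ (refl , refl) = here refl , there (here refl)
  ... | inj₂ unchanged     =
    let x∈L , y∈L = cov x y x<y (coloured ∘ trans unchanged) in there (there x∈L) , there (there y∈L)

  start-maker-shadow : ∀ {c} L → length L ≤ 2 * p → Covers c L →
    Σ (Fin N → Fin n) λ e₁ → Σ (Increasing e₁) λ e₁-inc → S₁.Shadowed e₁ e₁-inc c P1 (suc p)
  start-maker-shadow L |L|≤2p cov =
    let e₁ , e₁-inc , e₁-avoids = increasing-avoiding-list (2 * p) N L |L|≤2p
    in e₁ , e₁-inc , empty , maker , record
      { B-blue    = λ _ _ _ ()
      ; red-other = λ i j i<j red →
          contradiction (proj₁ (cov _ _ (e₁-inc i j i<j) λ free → just≢nothing (trans (sym red) free)))
                        (e₁-avoids i) }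

  covered⇒¬Full : ∀ {c} L → length L ≤ 2 * p → Covers c L → ¬ Full c
  covered⇒¬Full L |L|≤2p cov full =
    let e , e-inc , e-avoids = increasing-avoiding-list (2 * p) N L |L|≤2p
        0<1 = e-inc Fin.zero (Fin.suc Fin.zero) (s≤s z≤n)
    in e-avoids Fin.zero (proj₁ (cov _ _ 0<1 (full _ _ 0<1)))

  -- During Alice's first turn the list L holds the endpoints of her edges; the maker
  -- shadow on e₁ is started only afterwards, away from L. Each turn of Bob consists
  -- of p Breaker moves on e₂ followed by p + 1 Maker moves on e₁.
  data Phase (c : Board n) : Player → ℕ → Set where
    opening    : ∀ j L → length L + 2 * suc j ≤ 2 * p → Covers c L →
                 S₂.Shadowed c P1 (suc j) → Phase c P1 (suc j)
    alice-turn : ∀ j e₁ e₁-inc → S₁.Shadowed e₁ e₁-inc c P2 (suc j) →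
                 S₂.Shadowed c P1 (suc j) → Phase c P1 (suc j)
    bob-breaks : ∀ t e₁ e₁-inc → S₁.Shadowed e₁ e₁-inc c P1 (suc p) →
                 S₂.Shadowed c P2 (suc t) → Phase c P2 (suc (suc (t + p)))
    bob-makes  : ∀ j e₁ e₁-inc → S₁.Shadowed e₁ e₁-inc c P1 (suc j) →
                 S₂.Shadowed c P1 p → Phase c P2 (suc j)

  After : (Board n → Player → ℕ → Set) → Board n → Player → ℕ → Fin n → Fin n → Set
  After = Game.After n p q

  start-bob-turn : ∀ {c} e₁ e₁-inc → S₁.Shadowed e₁ e₁-inc c P1 (suc p) → S₂.Shadowed c P2 p →
                   Phase c P2 q
  start-bob-turn e₁ e₁-inc sh₁ sh₂ = subst (Phase _ P2)
    (solve 1 (λ p′ → con 2 :+ (p′ :+ (con 1 :+ p′)) := con 2 :* (con 1 :+ p′) :+ con 1) refl p′)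
    (bob-breaks p′ e₁ e₁-inc sh₁ sh₂)

  opening-length : ∀ l j → l + 2 * suc j ≤ 2 * p → suc (suc l) + 2 * j ≤ 2 * p
  opening-length l j = ℕ.≤-trans (ℕ.≤-reflexive
    (solve 2 (λ l j → (con 2 :+ l) :+ con 2 :* j := l :+ con 2 :* (con 1 :+ j)) refl l j))

  respond : ∀ {c mv k} → Phase c mv k → mv ≢ P2 → AllFree c (After Phase c mv k)
  respond (bob-breaks _ _ _ _ _) P2≢P2 = contradiction refl P2≢P2
  respond (bob-makes _ _ _ _ _)  P2≢P2 = contradiction refl P2≢P2
  respond (opening (suc j) L len cov sh₂) _ a b _ free =
    opening j (a ∷ b ∷ L) (opening-length _ (suc j) len) (covers-paint P1 cov) (S₂.simulate-red sh₂ free)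
  respond (opening zero L len cov sh₂) _ a b _ free =
    let e₁ , e₁-inc , sh₁ = start-maker-shadow (a ∷ b ∷ L)
          (ℕ.≤-trans (ℕ.m≤m+n _ 0) (opening-length _ 0 len)) (covers-paint P1 cov)
    in start-bob-turn e₁ e₁-inc sh₁ (S₂.simulate-red sh₂ free)
  respond (alice-turn (suc j) e₁ e₁-inc sh₁ sh₂) _ a b _ free =
    alice-turn j e₁ e₁-inc (S₁.simulate-red e₁ e₁-inc sh₁ free) (S₂.simulate-red sh₂ free)
  respond (alice-turn zero e₁ e₁-inc sh₁ sh₂) _ a b _ free =
    start-bob-turn e₁ e₁-inc (S₁.simulate-red e₁ e₁-inc sh₁ free) (S₂.simulate-red sh₂ free)

  advance : ∀ {c mv k} → Phase c mv k → mv ≡ P2 → ¬ Full c → FreeEdge c (After Phase c mv k)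
  advance (bob-breaks (suc t) e₁ e₁-inc sh₁ sh₂) refl ¬full = FreeEdge-map
    (λ a b → bob-breaks t e₁ e₁-inc (S₁.simulate-blue-elsewhere e₁ e₁-inc {a = a} {b} sh₁))
    (S₂.simulate-blue sh₂ ¬full)
  advance (bob-breaks zero e₁ e₁-inc sh₁ sh₂) refl ¬full = FreeEdge-map
    (λ a b → bob-makes p e₁ e₁-inc (S₁.simulate-blue-elsewhere e₁ e₁-inc {a = a} {b} sh₁))
    (S₂.simulate-blue sh₂ ¬full)
  advance (bob-makes (suc j) e₁ e₁-inc sh₁ sh₂) refl ¬full = FreeEdge-map
    (λ a b sh₁′ → bob-makes j e₁ e₁-inc sh₁′ (S₂.simulate-blue-elsewhere {a = a} {b} sh₂))
    (S₁.simulate-blue e₁ e₁-inc sh₁ ¬full)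
  advance (bob-makes zero e₁ e₁-inc sh₁ sh₂) refl ¬full = FreeEdge-map
    (λ a b sh₁′ → alice-turn p′ e₁ e₁-inc sh₁′ (S₂.simulate-blue-elsewhere {a = a} {b} sh₂))
    (S₁.simulate-blue e₁ e₁-inc sh₁ ¬full)

  P2-wins-at-end : ∀ {c mv k mv′ k′} e₁ e₁-inc → Full c → S₁.Shadowed e₁ e₁-inc c mv k →
                   S₂.Shadowed c mv′ k′ → P2WinsClique c
  P2-wins-at-end {c} e₁ e₁-inc full sh₁ sh₂ =
    let a , ω-red  = cliqueNumber-exists c P1
        b , ω-blue = cliqueNumber-exists c P2
    in a , b , ω-red , ω-blue ,
       ℕ.≤-trans (cliqueNumber-< {c = c} ω-red ¬big-red) (ℕ.≤-trans gap (cliqueNumber-≥ {c = c} ω-blue blue))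
    where
    blue : HasClique c P2 z
    blue = hasClique-induced e₁-inc {c} (maker-shadow⇒clique e₁-inc full sh₁)
    ¬big-red : ¬ HasClique c P1 (2 * p + suc y)
    ¬big-red red = breaker-shadow⇒¬clique e₂-inc sh₂ (hasClique-drop (2 * p) {c = c} red)

  goal : ∀ {c mv k} → Phase c mv k → Full c → P2WinsClique c
  goal (opening _ L len cov _)          full =
    contradiction full (covered⇒¬Full L (ℕ.≤-trans (ℕ.m≤m+n _ _) len) cov)
  goal (alice-turn _ e₁ e₁-inc sh₁ sh₂) full = P2-wins-at-end e₁ e₁-inc full sh₁ sh₂
  goal (bob-breaks _ e₁ e₁-inc sh₁ sh₂) full = P2-wins-at-end e₁ e₁-inc full sh₁ sh₂
  goal (bob-makes _ e₁ e₁-inc sh₁ sh₂)  full = P2-wins-at-end e₁ e₁-inc full sh₁ sh₂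

  bob-wins : WinsGame n p q P2 P2WinsClique
  bob-wins = Game.wins-by-invariant n p q Phase goal advance respond
    (opening p′ [] ℕ.≤-refl (λ _ _ _ coloured → contradiction refl coloured)
      (empty , breaker , record { B-blue = λ _ _ _ () ; red-other = λ _ _ _ () }))

theorem3p6 :
  ((m b : ℕ) → 1 ≤ m → 1 ≤ b → (D : ℕ) → ∃ λ N₀ → (N : ℕ) → N₀ ≤ N →
    (x y z : ℕ) → IsF N m (suc b) x → IsF N m b y → IsF N (suc m) b z →
    (1 + D + x ≤ y) × (1 + D + y ≤ z)) →
  (p : ℕ) → 1 ≤ p → ∃ λ n₀ → (n : ℕ) → n₀ ≤ n →
    WinsGame n p (2 * p + 1) P2 P2WinsClique
theorem3p6 gaps (suc p′) _ = 2 * p + suc (suc N₀) , bob-wins-large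
  where
  p = suc p′
  N₀ = proj₁ (gaps p p (s≤s z≤n) (s≤s z≤n) (2 * p))

  bob-wins-large : ∀ n → 2 * p + suc (suc N₀) ≤ n → WinsGame n p (2 * p + 1) P2 P2WinsClique
  bob-wins-large n n₀≤n =
    let o , n₀+o≡n = ℕ.m≤n⇒∃[o]m+o≡n n₀≤n
        N = suc (suc (N₀ + o))
        x , f[p,p+1]≡x = isF-exists N p (suc p)
        y , f[p,p]≡y   = isF-exists N p p
        z , f[p+1,p]≡z = isF-exists N (suc p) p
        _ , 1+2p+y≤z   = proj₂ (gaps p p (s≤s z≤n) (s≤s z≤n) (2 * p)) N
                           (ℕ.≤-trans (ℕ.m≤m+n N₀ o) (ℕ.m≤n+m (N₀ + o) 2))
                           x y z f[p,p+1]≡x f[p,p]≡y f[p+1,p]≡z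
    in subst (λ n → WinsGame n p (2 * p + 1) P2 P2WinsClique)
             (trans (sym (ℕ.+-assoc (2 * p) (suc (suc N₀)) o)) n₀+o≡n)
             (BobStrategy.bob-wins p′ (N₀ + o) y z (subst (_≤ z) (sym (ℕ.+-suc (2 * p) y)) 1+2p+y≤z)
               (proj₁ f[p+1,p]≡z) (proj₂ f[p,p]≡y))
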